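{- Let $v>k>i\ge 0$ be integers with $v\ge 2k$ and $(v,k,i)\neq(2k,k,0)$, let $X=J(v,k,i)$ and $\Delta=v-2k+2i$, and assume the girth of $X$ is $4$. Then the odd girth of $X$ is $og(X)=2\left\lceil\frac{k-i}{\Delta}\right\rceil+1$.
   Context: For integers $v>k>i\ge 0$, the generalized Johnson graph $J(v,k,i)$ is the simple undirected graph whose vertices are the $k$-element subsets of a fixed $v$-element set, two vertices $A,B$ being adjacent iff $|A\cap B|=i$. The girth is the length of a shortest cycle; the odd girth is the length of a shortest odd cycle. -}

module Defs where

open import Data.Nat using (ℕ; zero; suc; _+_; _*_; _∸_; _≤_; _<_)
open import Data.Nat.DivMod using (_/_)
open import Data.Fin.Subset using (Subset; ∣_∣; _∩_)
open import Data.Product using (Σ; _×_; ∃)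
open import Relation.Binary.PropositionalEquality using (_≡_)
open import Relation.Nullary using (¬_)

IsVertex : (v k : ℕ) → Subset v → Set
IsVertex v k A = ∣ A ∣ ≡ k

-- Adjacency in J(v,k,i): |A ∩ B| = i (for k-subsets; i < k ensures A ≠ B).
Adj : (v i : ℕ) → Subset v → Subset v → Set
Adj v i A B = ∣ A ∩ B ∣ ≡ i

record Cycle (v k i n : ℕ) : Set where
  field
    len≥3    : 3 ≤ n
    vert     : ℕ → Subset v
    isVert   : ∀ j → j < n → IsVertex v k (vert j)
    distinct : ∀ j l → j < n → l < n → vert j ≡ vert l → j ≡ l
    adj      : ∀ j → j < n → Adj v i (vert j) (vert (suc j))
    closed   : vert n ≡ vert 0

data Odd : ℕ → Set where
  odd1  : Odd 1
  odd+2 : ∀ {n} → Odd n → Odd (suc (suc n))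

Girth : (v k i g : ℕ) → Set
Girth v k i g = Cycle v k i g × (∀ n → Cycle v k i n → g ≤ n)

OddGirth : (v k i g : ℕ) → Set
OddGirth v k i g = (Odd g × Cycle v k i g) × (∀ n → Odd n → Cycle v k i n → g ≤ n)

-- ceiling division ⌈ a / b ⌉ (only used with b > 0; value at b = 0 is irrelevant).
ceilDiv : ℕ → ℕ → ℕ
ceilDiv a zero    = 0
ceilDiv a (suc b) = (a + b) / suc b

-- Write k = i + a, v = 2k + s and Δ = s + 2i; Δ = 0 exactly in the excluded case (2k, k, 0).
-- For k-sets A ~ B ~ C, counting A ∪ B ∪ C inside the v-set gives |A ∩ C| ≥ k − Δ, and chaining
-- this with |A ∩ B| + |B ∩ D| ≤ |B| + |A ∩ D| shows that the ends of a walk of length 2h meet in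
-- at least k − hΔ points.  In a closed walk of length 2h + 1 these ends are adjacent, so i ≥ k − hΔ,
-- that is h ≥ ⌈a / Δ⌉.  Conversely, intervals [c, c + k) whose offsets climb from 0 to a in steps
-- of at most Δ, joined through common neighbours, close up into a walk of length 2⌈a / Δ⌉ + 1, and
-- a shortest odd closed walk is a cycle.

module Submission where

open import Defs
open import Data.Bool using (Bool; true; false; _∧_)
open import Data.Bool.Properties using (∧-zeroʳ)
open import Data.Empty using (⊥-elim)
open import Data.Fin.Subset using (Subset; ∣_∣; _∩_; _∪_; inside; outside; _⊆_)
open import Data.Fin.Subset.Properties
  using (∣p∣≤n; p⊆q⇒∣p∣≤∣q∣; x∈p∩q⁺; x∈p∩q⁻; x∈p∪q⁻; ∩-distribʳ-∪; ∩-comm; ∩-idem)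
open import Data.List using (List; []; _∷_; _++_; replicate; length; take; drop; zipWith)
open import Data.List.Properties
  using (length-zipWith; take-[]; zipWith-zeroʳ; length-++; length-replicate; ++-assoc; ++-identityʳ)
open import Data.Nat
open import Data.Nat.DivMod
  using (_/_; _%_; m≡m%n+[m/n]*n; [m+kn]%n≡m%n; [m+n]%n≡m%n; m≤n⇒m%n≡m; m<n⇒m%n≡m; n%n≡0; m%n<n; m<n*o⇒m/o<n)
open import Data.Nat.Properties
open import Algebra.Properties.CommutativeSemigroup +-commutativeSemigroup using (xy∙z≈xz∙y)
open import Data.Nat.Tactic.RingSolver using (solve-∀)
open import Data.Product using (_×_; _,_; proj₁; proj₂; ∃; ∃₂; ∃-syntax)
open import Data.Sum using (_⊎_; inj₁; inj₂; [_,_]′)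
import Data.Sum as Sum
open import Data.Vec using ([]; _∷_)
open import Function using (_∘_)
open import Relation.Binary using (tri<; tri≈; tri>)
open import Relation.Binary.PropositionalEquality
open import Relation.Nullary using (¬_; yes; no)

∣p∪q∣+∣p∩q∣≡∣p∣+∣q∣ : ∀ {n} (p q : Subset n) → ∣ p ∪ q ∣ + ∣ p ∩ q ∣ ≡ ∣ p ∣ + ∣ q ∣
∣p∪q∣+∣p∩q∣≡∣p∣+∣q∣ []            []            = refl
∣p∪q∣+∣p∩q∣≡∣p∣+∣q∣ (inside  ∷ p) (inside  ∷ q) =
  cong suc (trans (+-suc _ _) (trans (cong suc (∣p∪q∣+∣p∩q∣≡∣p∣+∣q∣ p q)) (sym (+-suc _ _))))
∣p∪q∣+∣p∩q∣≡∣p∣+∣q∣ (inside  ∷ p) (outside ∷ q) = cong suc (∣p∪q∣+∣p∩q∣≡∣p∣+∣q∣ p q)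
∣p∪q∣+∣p∩q∣≡∣p∣+∣q∣ (outside ∷ p) (inside  ∷ q) =
  trans (cong suc (∣p∪q∣+∣p∩q∣≡∣p∣+∣q∣ p q)) (sym (+-suc _ _))
∣p∪q∣+∣p∩q∣≡∣p∣+∣q∣ (outside ∷ p) (outside ∷ q) = ∣p∪q∣+∣p∩q∣≡∣p∣+∣q∣ p q

∣p∪q∣≤∣p∣+∣q∣ : ∀ {n} (p q : Subset n) → ∣ p ∪ q ∣ ≤ ∣ p ∣ + ∣ q ∣
∣p∪q∣≤∣p∣+∣q∣ p q = ≤-trans (m≤m+n _ _) (≤-reflexive (∣p∪q∣+∣p∩q∣≡∣p∣+∣q∣ p q))

∣p∩q∣+∣q∩r∣≤∣q∣+∣p∩r∣ : ∀ {n} (p q r : Subset n) → ∣ p ∩ q ∣ + ∣ q ∩ r ∣ ≤ ∣ q ∣ + ∣ p ∩ r ∣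
∣p∩q∣+∣q∩r∣≤∣q∣+∣p∩r∣ p q r = begin
  ∣ p ∩ q ∣ + ∣ q ∩ r ∣                               ≡⟨ ∣p∪q∣+∣p∩q∣≡∣p∣+∣q∣ (p ∩ q) (q ∩ r) ⟨
  ∣ (p ∩ q) ∪ (q ∩ r) ∣ + ∣ (p ∩ q) ∩ (q ∩ r) ∣   ≤⟨ +-mono-≤ (p⊆q⇒∣p∣≤∣q∣ ∪⊆q) (p⊆q⇒∣p∣≤∣q∣ ∩⊆p∩r) ⟩
  ∣ q ∣ + ∣ p ∩ r ∣                               ∎
  where
  open ≤-Reasoning
  ∪⊆q : (p ∩ q) ∪ (q ∩ r) ⊆ q
  ∪⊆q = [ proj₂ ∘ x∈p∩q⁻ p q , proj₁ ∘ x∈p∩q⁻ q r ]′ ∘ x∈p∪q⁻ (p ∩ q) (q ∩ r)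
  ∩⊆p∩r : (p ∩ q) ∩ (q ∩ r) ⊆ p ∩ r
  ∩⊆p∩r x∈ with x∈p∩q⁻ (p ∩ q) (q ∩ r) x∈
  ... | x∈pq , x∈qr = x∈p∩q⁺ (proj₁ (x∈p∩q⁻ p q x∈pq) , proj₂ (x∈p∩q⁻ q r x∈qr))

∣p∣+∣q∣+∣r∣≤n+∣p∩q∣+∣q∩r∣+∣p∩r∣ : ∀ {n} (p q r : Subset n) →
  ∣ p ∣ + ∣ q ∣ + ∣ r ∣ ≤ n + (∣ p ∩ q ∣ + ∣ q ∩ r ∣ + ∣ p ∩ r ∣)
∣p∣+∣q∣+∣r∣≤n+∣p∩q∣+∣q∩r∣+∣p∩r∣ {n} p q r = begin
  ∣ p ∣ + ∣ q ∣ + ∣ r ∣                           ≡⟨ xy∙z≈xz∙y (∣ p ∣) (∣ q ∣) (∣ r ∣) ⟩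
  (∣ p ∣ + ∣ r ∣) + ∣ q ∣                         ≡⟨ cong (_+ ∣ q ∣) (∣p∪q∣+∣p∩q∣≡∣p∣+∣q∣ p r) ⟨
  ∣ p ∪ r ∣ + ∣ p ∩ r ∣ + ∣ q ∣                   ≡⟨ xy∙z≈xz∙y (∣ p ∪ r ∣) (∣ p ∩ r ∣) (∣ q ∣) ⟩
  (∣ p ∪ r ∣ + ∣ q ∣) + ∣ p ∩ r ∣
    ≡⟨ cong (_+ ∣ p ∩ r ∣) (∣p∪q∣+∣p∩q∣≡∣p∣+∣q∣ (p ∪ r) q) ⟨
  ∣ (p ∪ r) ∪ q ∣ + ∣ (p ∪ r) ∩ q ∣ + ∣ p ∩ r ∣
    ≡⟨ cong (λ x → ∣ (p ∪ r) ∪ q ∣ + ∣ x ∣ + ∣ p ∩ r ∣) (∩-distribʳ-∪ q p r) ⟩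
  ∣ (p ∪ r) ∪ q ∣ + ∣ (p ∩ q) ∪ (r ∩ q) ∣ + ∣ p ∩ r ∣
    ≤⟨ +-monoˡ-≤ (∣ p ∩ r ∣) (+-mono-≤ (∣p∣≤n ((p ∪ r) ∪ q)) (∣p∪q∣≤∣p∣+∣q∣ (p ∩ q) (r ∩ q))) ⟩
  n + (∣ p ∩ q ∣ + ∣ r ∩ q ∣) + ∣ p ∩ r ∣
    ≡⟨ cong (λ x → n + (∣ p ∩ q ∣ + ∣ x ∣) + ∣ p ∩ r ∣) (∩-comm r q) ⟩
  n + (∣ p ∩ q ∣ + ∣ q ∩ r ∣) + ∣ p ∩ r ∣         ≡⟨ +-assoc n _ _ ⟩
  n + (∣ p ∩ q ∣ + ∣ q ∩ r ∣ + ∣ p ∩ r ∣)         ∎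
  where open ≤-Reasoning

-- Closed walks

Odd-+⁻ : ∀ {d e} → Odd (d + e) → Odd d ⊎ Odd e
Odd-+⁻ {zero}        o          = inj₂ o
Odd-+⁻ {suc zero}    _          = inj₁ odd1
Odd-+⁻ {suc (suc d)} (odd+2 o)  = Sum.map₁ odd+2 (Odd-+⁻ o)

Odd-1+2* : ∀ h → Odd (suc (2 * h))
Odd-1+2* zero    = odd1
Odd-1+2* (suc h) = subst (Odd ∘ suc) (sym (*-suc 2 h)) (odd+2 (Odd-1+2* h))

Odd⇒≡1+2* : ∀ {n} → Odd n → ∃ λ h → n ≡ suc (2 * h)
Odd⇒≡1+2* odd1      = 0 , refl
Odd⇒≡1+2* (odd+2 o) with Odd⇒≡1+2* o
... | h , refl = suc h , cong suc (sym (*-suc 2 h))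

[1+m]%n≡[1+m%n]%n : ∀ m n → suc m % suc n ≡ suc (m % suc n) % suc n
[1+m]%n≡[1+m%n]%n m n =
  trans (cong (λ y → suc y % suc n) (m≡m%n+[m/n]*n m (suc n)))
        ([m+kn]%n≡m%n (suc (m % suc n)) (m / suc n) (suc n))

interleave : ∀ {X : Set} → (ℕ → X) → (ℕ → X) → ℕ → X
interleave f g zero          = f 0
interleave f g (suc zero)    = g 0
interleave f g (suc (suc x)) = interleave (f ∘ suc) (g ∘ suc) x

interleave-2* : ∀ {X : Set} (f g : ℕ → X) m → interleave f g (2 * m) ≡ f m
interleave-2* f g zero    = refl
interleave-2* f g (suc m) =
  trans (cong (interleave f g) (*-suc 2 m)) (interleave-2* (f ∘ suc) (g ∘ suc) m)

module _ {X : Set} (_~_ : X → X → Set) where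

  interleave-edge : ∀ {f g} → (∀ j → f j ~ g j) → (∀ j → g j ~ f (suc j)) →
                    ∀ x → interleave f g x ~ interleave f g (suc x)
  interleave-edge f~g g~f zero          = f~g 0
  interleave-edge f~g g~f (suc zero)    = g~f 0
  interleave-edge f~g g~f (suc (suc x)) = interleave-edge (f~g ∘ suc) (g~f ∘ suc) x

  Walk : ℕ → (ℕ → X) → Set
  Walk n w = ∀ j → j < n → w j ~ w (suc j)

  ClosedWalk : ℕ → (ℕ → X) → Set
  ClosedWalk n w = Walk n w × w n ≡ w 0

  closedWalk-segment : ∀ {u : ℕ → X} p d → (∀ x → u x ~ u (suc x)) → u p ≡ u (p + d) →
                       ClosedWalk d (λ x → u (p + x))
  closedWalk-segment {u} p d edge loop =
    (λ x _ → subst (u (p + x) ~_) (cong u (sym (+-suc p x))) (edge (p + x))) ,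
    trans (sym loop) (cong u (sym (+-identityʳ p)))

  periodic-walk : ∀ {n w} → Walk n w → w n ~ w 0 → ∀ x → w (x % suc n) ~ w (suc x % suc n)
  periodic-walk {n} {w} walk back x =
    subst (w (x % suc n) ~_) (cong w (sym ([1+m]%n≡[1+m%n]%n x n))) (step (x % suc n) (≤-pred (m%n<n x (suc n))))
    where
    step : ∀ r → r ≤ n → w r ~ w (suc r % suc n)
    step r r≤n with m≤n⇒m<n∨m≡n r≤n
    ... | inj₁ r<n  rewrite m≤n⇒m%n≡m r<n = walk r r<n
    ... | inj₂ refl = subst (λ y → w r ~ w y) (sym (n%n≡0 (suc r))) back

  closedWalk-periodic : ∀ {n w} → Walk n w → w n ~ w 0 → ClosedWalk (suc n) (λ x → w (x % suc n))
  closedWalk-periodic {n} {w} walk back =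
    closedWalk-segment 0 (suc n) (periodic-walk walk back) (cong w (sym (n%n≡0 (suc n))))

  module _ {n w} (odd : Odd (suc n)) (closedWalk : ClosedWalk (suc n) w)
           (shortest : ∀ {n′ w′} → Odd n′ → ClosedWalk n′ w′ → suc n ≤ n′) where

    private
      ŵ : ℕ → X
      ŵ x = w (x % suc n)

      ŵ-edge : ∀ x → ŵ x ~ ŵ (suc x)
      ŵ-edge = periodic-walk (λ x x<n → proj₁ closedWalk x (m≤n⇒m≤1+n x<n))
                             (subst (w n ~_) (proj₂ closedWalk) (proj₁ closedWalk n ≤-refl))

      ŵ≡w : ∀ {p} → p < suc n → ŵ p ≡ w p
      ŵ≡w p<n = cong w (m<n⇒m%n≡m p<n)

    -- A repeated vertex w j = w (j + d) splits the periodic walk into closed walks of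
    -- lengths d and n − d; one of them is odd, and both are shorter than n.
    shortestOddClosedWalk-noRepeat : ∀ {j l} → j < l → l < suc n → w j ≢ w l
    shortestOddClosedWalk-noRepeat {j} j<l l<n wj≡wl with m≤n⇒∃[o]m+o≡n j<l
    ... | d , refl = [ (λ odd-d → <⇒≱ (≤-<-trans (s≤s (m≤n+m d j)) l<n)
                                      (shortest odd-d (closedWalk-segment j (suc d) ŵ-edge inner)))
                     , (λ odd-e → <⇒≱ (s≤s (m∸n≤m n d))
                                      (shortest odd-e (closedWalk-segment (suc (j + d)) (n ∸ d) ŵ-edge outer)))
                     ]′ (Odd-+⁻ {suc d} {n ∸ d} (subst (Odd ∘ suc) (sym (m+[n∸m]≡n d≤n)) odd))
      where
      open ≡-Reasoning
      d≤n : d ≤ n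
      d≤n = ≤-trans (m≤n+m d j) (≤-pred (<⇒≤ l<n))
      repeat : ŵ j ≡ ŵ (suc (j + d))
      repeat = begin
        ŵ j               ≡⟨ ŵ≡w (<-trans j<l l<n) ⟩
        w j               ≡⟨ wj≡wl ⟩
        w (suc (j + d))   ≡⟨ ŵ≡w l<n ⟨
        ŵ (suc (j + d))   ∎
      inner : ŵ j ≡ ŵ (j + suc d)
      inner = trans repeat (cong ŵ (sym (+-suc j d)))
      outer : ŵ (suc (j + d)) ≡ ŵ (suc (j + d) + (n ∸ d))
      outer = begin
        ŵ (suc (j + d))             ≡⟨ repeat ⟨
        ŵ j                         ≡⟨ cong w ([m+n]%n≡m%n j (suc n)) ⟨
        ŵ (j + suc n)               ≡⟨ cong (λ m → ŵ (j + suc m)) (m+[n∸m]≡n d≤n) ⟨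
        ŵ (j + suc (d + (n ∸ d)))   ≡⟨ cong ŵ (+-assoc j (suc d) (n ∸ d)) ⟨
        ŵ (j + suc d + (n ∸ d))     ≡⟨ cong (λ m → ŵ (m + (n ∸ d))) (+-suc j d) ⟩
        ŵ (suc (j + d) + (n ∸ d))   ∎

    shortestOddClosedWalk-injective : ∀ {j l} → j < suc n → l < suc n → w j ≡ w l → j ≡ l
    shortestOddClosedWalk-injective {j} {l} j<n l<n wj≡wl with <-cmp j l
    ... | tri< j<l _ _ = ⊥-elim (shortestOddClosedWalk-noRepeat j<l l<n wj≡wl)
    ... | tri≈ _ j≡l _ = j≡l
    ... | tri> _ _ l<j = ⊥-elim (shortestOddClosedWalk-noRepeat l<j j<n (sym wj≡wl))

-- The lower bound in J(v, k, i)

record Edge (v k i : ℕ) (A B : Subset v) : Set where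
  constructor edge
  field
    source   : IsVertex v k A
    target   : IsVertex v k B
    adjacent : Adj v i A B

open Edge

module _ {k s i : ℕ} where

  private
    _~_ : Subset (2 * k + s) → Subset (2 * k + s) → Set
    _~_ = Edge (2 * k + s) k i

  twoStep-∩-bound : ∀ {A B C} → A ~ B → B ~ C → k ≤ ∣ A ∩ C ∣ + (s + 2 * i)
  twoStep-∩-bound {A} {B} {C} (edge ∣A∣≡k ∣B∣≡k ∣A∩B∣≡i) (edge _ ∣C∣≡k ∣B∩C∣≡i) =
    +-cancelˡ-≤ (2 * k) k _ (begin
      2 * k + k                                  ≡⟨ lhs k ⟩
      k + k + k                                  ≡⟨ cong₂ _+_ (cong₂ _+_ ∣A∣≡k ∣B∣≡k) ∣C∣≡k ⟨
      ∣ A ∣ + ∣ B ∣ + ∣ C ∣                      ≤⟨ ∣p∣+∣q∣+∣r∣≤n+∣p∩q∣+∣q∩r∣+∣p∩r∣ A B C ⟩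
      2 * k + s + (∣ A ∩ B ∣ + ∣ B ∩ C ∣ + ∣ A ∩ C ∣)
        ≡⟨ cong (λ x → 2 * k + s + (x + ∣ A ∩ C ∣)) (cong₂ _+_ ∣A∩B∣≡i ∣B∩C∣≡i) ⟩
      2 * k + s + (i + i + ∣ A ∩ C ∣)            ≡⟨ rhs k s i (∣ A ∩ C ∣) ⟩
      2 * k + (∣ A ∩ C ∣ + (s + 2 * i))          ∎)
    where
    open ≤-Reasoning
    lhs : ∀ k → 2 * k + k ≡ k + k + k
    lhs = solve-∀
    rhs : ∀ k s i x → 2 * k + s + (i + i + x) ≡ 2 * k + (x + (s + 2 * i))
    rhs = solve-∀

  evenWalk-∩-bound : ∀ h {u} → Walk _~_ (2 * h) u → ∣ u 0 ∣ ≤ ∣ u 0 ∩ u (2 * h) ∣ + h * (s + 2 * i)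
  evenWalk-∩-bound zero    {u} _    = ≤-reflexive (trans (cong ∣_∣ (sym (∩-idem (u 0)))) (sym (+-identityʳ _)))
  evenWalk-∩-bound (suc h) {u} walk =
    subst (λ x → ∣ u 0 ∣ ≤ ∣ u 0 ∩ u x ∣ + suc h * Δ) (sym (*-suc 2 h))
      (+-cancelˡ-≤ (∣ u 2 ∣) _ _ (begin
        ∣ u 2 ∣ + ∣ u 0 ∣                            ≤⟨ +-mono-≤ ih (≤-trans (≤-reflexive ∣u0∣≡k) pair) ⟩
        (∣ u 2 ∩ u e ∣ + h * Δ) + (∣ u 0 ∩ u 2 ∣ + Δ) ≡⟨ shuffle (∣ u 2 ∩ u e ∣) (h * Δ) (∣ u 0 ∩ u 2 ∣) Δ ⟩
        (∣ u 0 ∩ u 2 ∣ + ∣ u 2 ∩ u e ∣) + (h * Δ + Δ)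
          ≤⟨ +-monoˡ-≤ (h * Δ + Δ) (∣p∩q∣+∣q∩r∣≤∣q∣+∣p∩r∣ (u 0) (u 2) (u e)) ⟩
        (∣ u 2 ∣ + ∣ u 0 ∩ u e ∣) + (h * Δ + Δ)       ≡⟨ regroup (∣ u 2 ∣) (∣ u 0 ∩ u e ∣) h Δ ⟩
        ∣ u 2 ∣ + (∣ u 0 ∩ u e ∣ + suc h * Δ)         ∎))
    where
    open ≤-Reasoning
    Δ = s + 2 * i
    e = 2 + 2 * h
    walk′ : Walk _~_ e u
    walk′ = subst (λ n → Walk _~_ n u) (*-suc 2 h) walk
    pair : k ≤ ∣ u 0 ∩ u 2 ∣ + Δ
    pair = twoStep-∩-bound (walk′ 0 (s≤s z≤n)) (walk′ 1 (s≤s (s≤s z≤n)))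
    ∣u0∣≡k : ∣ u 0 ∣ ≡ k
    ∣u0∣≡k = source (walk′ 0 (s≤s z≤n))
    ih : ∣ u 2 ∣ ≤ ∣ u 2 ∩ u e ∣ + h * Δ
    ih = evenWalk-∩-bound h (λ x x<2h → walk′ (2 + x) (s≤s (s≤s x<2h)))
    shuffle : ∀ a b c d → (a + b) + (c + d) ≡ (c + a) + (b + d)
    shuffle = solve-∀
    regroup : ∀ a b h d → (a + b) + (h * d + d) ≡ a + (b + suc h * d)
    regroup = solve-∀

  oddClosedWalk-bound : ∀ h {u} → ClosedWalk _~_ (suc (2 * h)) u → k ≤ i + h * (s + 2 * i)
  oddClosedWalk-bound h {u} (walk , closed) = begin
    k                                      ≡⟨ source (walk 0 (s≤s z≤n)) ⟨
    ∣ u 0 ∣                                ≤⟨ evenWalk-∩-bound h (λ x x<2h → walk x (m≤n⇒m≤1+n x<2h)) ⟩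
    ∣ u 0 ∩ u (2 * h) ∣ + h * (s + 2 * i)  ≡⟨ cong (_+ h * (s + 2 * i)) ∣u0∩u2h∣≡i ⟩
    i + h * (s + 2 * i)                    ∎
    where
    open ≤-Reasoning
    ∣u0∩u2h∣≡i : ∣ u 0 ∩ u (2 * h) ∣ ≡ i
    ∣u0∩u2h∣≡i = begin-equality
      ∣ u 0 ∩ u (2 * h) ∣            ≡⟨ cong ∣_∣ (∩-comm (u 0) (u (2 * h))) ⟩
      ∣ u (2 * h) ∩ u 0 ∣            ≡⟨ cong (λ x → ∣ u (2 * h) ∩ x ∣) closed ⟨
      ∣ u (2 * h) ∩ u (suc (2 * h)) ∣ ≡⟨ adjacent (walk (2 * h) ≤-refl) ⟩
      i                              ∎

cycle⇒closedWalk : ∀ {v k i n} (C : Cycle v k i n) → ClosedWalk (Edge v k i) n (Cycle.vert C)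
cycle⇒closedWalk {v} {k} {i} {n} C =
  (λ j j<n → edge (isVert j j<n) (successor j j<n) (adj j j<n)) , closed
  where
  open Cycle C
  successor : ∀ j → j < n → IsVertex v k (vert (suc j))
  successor j j<n with m≤n⇒m<n∨m≡n j<n
  ... | inj₁ 1+j<n = isVert (suc j) 1+j<n
  ... | inj₂ 1+j≡n = subst (IsVertex v k ∘ vert) (sym 1+j≡n)
                       (subst (IsVertex v k) (sym closed) (isVert 0 (≤-trans (s≤s z≤n) j<n)))

-- Subsets of Fin v given by runs

trues : List Bool → ℕ
trues []           = 0
trues (true  ∷ bs) = suc (trues bs)
trues (false ∷ bs) = trues bs

trues-++ : ∀ xs ys → trues (xs ++ ys) ≡ trues xs + trues ys
trues-++ []           ys = refl
trues-++ (true  ∷ xs) ys = cong suc (trues-++ xs ys)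
trues-++ (false ∷ xs) ys = trues-++ xs ys

trues-replicate-true : ∀ n → trues (replicate n true) ≡ n
trues-replicate-true zero    = refl
trues-replicate-true (suc n) = cong suc (trues-replicate-true n)

trues-replicate-false : ∀ n → trues (replicate n false) ≡ 0
trues-replicate-false zero    = refl
trues-replicate-false (suc n) = trues-replicate-false n

take-length-++ : ∀ {A : Set} (xs ys : List A) → take (length xs) (xs ++ ys) ≡ xs
take-length-++ []       ys = refl
take-length-++ (x ∷ xs) ys = cong (x ∷_) (take-length-++ xs ys)

drop-length-++ : ∀ {A : Set} (xs ys : List A) → drop (length xs) (xs ++ ys) ≡ ys
drop-length-++ []       ys = refl
drop-length-++ (x ∷ xs) ys = drop-length-++ xs ys

length-zipWith-≤ˡ : ∀ {A B C : Set} (f : A → B → C) xs ys → length (zipWith f xs ys) ≤ length xs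
length-zipWith-≤ˡ f xs ys = ≤-trans (≤-reflexive (length-zipWith f xs ys)) (m⊓n≤m (length xs) (length ys))

replicate-+ : ∀ {A : Set} m n (x : A) → replicate (m + n) x ≡ replicate m x ++ replicate n x
replicate-+ zero    n x = refl
replicate-+ (suc m) n x = cong (x ∷_) (replicate-+ m n x)

-- A list read as a characteristic vector, truncated or padded with outside to length v.
⟦_⟧ : ∀ {v} → List Bool → Subset v
⟦_⟧ {zero}  _        = []
⟦_⟧ {suc v} []       = outside ∷ ⟦ [] ⟧
⟦_⟧ {suc v} (b ∷ bs) = b ∷ ⟦ bs ⟧

∣⟦[]⟧∣≡0 : ∀ v → ∣ ⟦_⟧ {v} [] ∣ ≡ 0
∣⟦[]⟧∣≡0 zero    = refl
∣⟦[]⟧∣≡0 (suc v) = ∣⟦[]⟧∣≡0 v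

∣⟦bs⟧∣≡trues : ∀ {v} bs → length bs ≤ v → ∣ ⟦_⟧ {v} bs ∣ ≡ trues bs
∣⟦bs⟧∣≡trues {v}     []           _         = ∣⟦[]⟧∣≡0 v
∣⟦bs⟧∣≡trues {suc v} (true  ∷ bs) (s≤s len) = cong suc (∣⟦bs⟧∣≡trues bs len)
∣⟦bs⟧∣≡trues {suc v} (false ∷ bs) (s≤s len) = ∣⟦bs⟧∣≡trues bs len

⟦⟧-∩ : ∀ {v} xs ys → ⟦_⟧ {v} xs ∩ ⟦ ys ⟧ ≡ ⟦ zipWith _∧_ xs ys ⟧
⟦⟧-∩ {zero}  _        _        = refl
⟦⟧-∩ {suc v} []       []       = cong (outside ∷_) (⟦⟧-∩ [] [])
⟦⟧-∩ {suc v} []       (y ∷ ys) = cong (outside ∷_) (⟦⟧-∩ [] ys)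
⟦⟧-∩ {suc v} (x ∷ xs) []       =
  cong₂ _∷_ (∧-zeroʳ x) (trans (⟦⟧-∩ xs []) (cong ⟦_⟧ (zipWith-zeroʳ _∧_ xs)))
⟦⟧-∩ {suc v} (x ∷ xs) (y ∷ ys) = cong ((x ∧ y) ∷_) (⟦⟧-∩ xs ys)

Runs : Set
Runs = List (ℕ × Bool)

expand : Runs → List Bool
expand []             = []
expand ((n , b) ∷ rs) = replicate n b ++ expand rs

span : Runs → ℕ
span []             = 0
span ((n , _) ∷ rs) = n + span rs

weight : Runs → ℕ
weight []                 = 0
weight ((n , true)  ∷ rs) = n + weight rs
weight ((n , false) ∷ rs) = weight rs

length-expand : ∀ rs → length (expand rs) ≡ span rs
length-expand []             = refl
length-expand ((n , b) ∷ rs) =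
  trans (length-++ (replicate n b)) (cong₂ _+_ (length-replicate n) (length-expand rs))

trues-expand : ∀ rs → trues (expand rs) ≡ weight rs
trues-expand []                 = refl
trues-expand ((n , true)  ∷ rs) =
  trans (trues-++ (replicate n true) _) (cong₂ _+_ (trues-replicate-true n) (trues-expand rs))
trues-expand ((n , false) ∷ rs) =
  trans (trues-++ (replicate n false) _) (cong₂ _+_ (trues-replicate-false n) (trues-expand rs))

expand-++ : ∀ rs ss → expand (rs ++ ss) ≡ expand rs ++ expand ss
expand-++ []             ss = refl
expand-++ ((n , b) ∷ rs) ss =
  trans (cong (replicate n b ++_) (expand-++ rs ss)) (sym (++-assoc (replicate n b) _ _))

expand-split : ∀ m n b rs → expand ((m + n , b) ∷ rs) ≡ expand ((m , b) ∷ (n , b) ∷ rs)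
expand-split m n b rs = trans (cong (_++ expand rs) (replicate-+ m n b)) (++-assoc (replicate m b) _ _)

∣⟦expand⟧∣≡weight : ∀ {v} rs → span rs ≤ v → ∣ ⟦_⟧ {v} (expand rs) ∣ ≡ weight rs
∣⟦expand⟧∣≡weight rs len =
  trans (∣⟦bs⟧∣≡trues (expand rs) (≤-trans (≤-reflexive (length-expand rs)) len)) (trues-expand rs)

interval : ∀ {v} → ℕ → ℕ → Subset v
interval p q = ⟦ expand ((p , false) ∷ (q , true) ∷ []) ⟧

trues-window : ∀ p q bs →
  trues (zipWith _∧_ (replicate p false ++ replicate q true) bs) ≡ trues (take q (drop p bs))
trues-window zero    zero    bs           = refl
trues-window zero    (suc q) []           = refl
trues-window zero    (suc q) (true  ∷ bs) = cong suc (trues-window zero q bs)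
trues-window zero    (suc q) (false ∷ bs) = trues-window zero q bs
trues-window (suc p) q       []           = cong trues (sym (take-[] q))
trues-window (suc p) q       (b ∷ bs)     = trues-window p q bs

∣interval∣ : ∀ {v} p q → p + q ≤ v → ∣ interval {v} p q ∣ ≡ q
∣interval∣ p q len =
  trans (∣⟦expand⟧∣≡weight ((p , false) ∷ (q , true) ∷ []) (≤-trans (≤-reflexive (cong (p +_) (+-identityʳ q))) len))
        (+-identityʳ q)

window-expand : ∀ rs ss ts → take (span ss) (drop (span rs) (expand (rs ++ ss ++ ts))) ≡ expand ss
window-expand rs ss ts
  rewrite expand-++ rs (ss ++ ts) | expand-++ ss ts | sym (length-expand rs) | sym (length-expand ss)
  = trans (cong (take _) (drop-length-++ (expand rs) _)) (take-length-++ (expand ss) _)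

∣interval∩⟦expand⟧∣ : ∀ {v p q} rs ss ts → span rs ≡ p → span ss ≡ q → p + q ≤ v →
  ∣ interval {v} p q ∩ ⟦ expand (rs ++ ss ++ ts) ⟧ ∣ ≡ weight ss
∣interval∩⟦expand⟧∣ {v} {p} {q} rs ss ts refl refl len = begin
  ∣ interval {v} p q ∩ ⟦ bs ⟧ ∣                            ≡⟨ cong ∣_∣ (⟦⟧-∩ {v} window bs) ⟩
  ∣ ⟦_⟧ {v} (zipWith _∧_ window bs) ∣                      ≡⟨ ∣⟦bs⟧∣≡trues (zipWith _∧_ window bs) short ⟩
  trues (zipWith _∧_ window bs)
    ≡⟨ cong (λ xs → trues (zipWith _∧_ (replicate p false ++ xs) bs)) (++-identityʳ _) ⟩
  trues (zipWith _∧_ (replicate p false ++ replicate q true) bs) ≡⟨ trues-window p q bs ⟩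
  trues (take q (drop p bs))                              ≡⟨ cong trues (window-expand rs ss ts) ⟩
  trues (expand ss)                                       ≡⟨ trues-expand ss ⟩
  weight ss                                               ∎
  where
  open ≡-Reasoning
  window = expand ((p , false) ∷ (q , true) ∷ [])
  bs = expand (rs ++ ss ++ ts)
  short : length (zipWith _∧_ window bs) ≤ v
  short = ≤-trans (length-zipWith-≤ˡ _∧_ window bs)
            (≤-trans (≤-reflexive (trans (length-expand ((p , false) ∷ (q , true) ∷ [])) (cong (p +_) (+-identityʳ q))))
                     len)

∣interval∩shifted∣ : ∀ {v} i a → i + a ≤ v → ∣ interval {v} 0 (i + a) ∩ interval a (i + a) ∣ ≡ i
∣interval∩shifted∣ {v} i a len = begin
  ∣ interval {v} 0 (i + a) ∩ interval a (i + a) ∣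
    ≡⟨ cong (λ bs → ∣ interval {v} 0 (i + a) ∩ ⟦ bs ⟧ ∣) split ⟩
  ∣ interval {v} 0 (i + a) ∩ ⟦ expand ((a , false) ∷ (i , true) ∷ (a , true) ∷ []) ⟧ ∣
    ≡⟨ ∣interval∩⟦expand⟧∣ [] ((a , false) ∷ (i , true) ∷ []) ((a , true) ∷ []) refl width len ⟩
  i + 0                                                             ≡⟨ +-identityʳ i ⟩
  i                                                                 ∎
  where
  open ≡-Reasoning
  split : expand ((a , false) ∷ (i + a , true) ∷ []) ≡
          expand ((a , false) ∷ (i , true) ∷ (a , true) ∷ [])
  split = cong (replicate a false ++_) (expand-split i a true [])
  width : a + (i + 0) ≡ i + a
  width = trans (cong (a +_) (+-identityʳ i)) (+-comm a i)

-- The odd cycle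

m≤n⇒m+n≤2*n+o : ∀ {m n} o → m ≤ n → m + n ≤ 2 * n + o
m≤n⇒m+n≤2*n+o {m} {n} o m≤n =
  ≤-trans (+-monoˡ-≤ n m≤n) (≤-trans (≤-reflexive (cong (n +_) (sym (+-identityʳ n)))) (m≤m+n (2 * n) o))

shift-split : ∀ {t s i} → t ≤ s + 2 * i → ∃₂ λ y w → t ≡ y + w × y ≤ i × w ≤ s + i
shift-split {t} {s} {i} t≤ with t ≤? s + i
... | yes t≤s+i = 0 , t , refl , z≤n , t≤s+i
... | no  t≰s+i with m≤n⇒∃[o]m+o≡n (<⇒≤ (≰⇒> t≰s+i))
...   | y , refl = y , s + i , +-comm (s + i) y , y≤i , ≤-refl
  where
  y≤i : y ≤ i
  y≤i = +-cancelˡ-≤ (s + i) y i (≤-trans t≤ (≤-reflexive (s+2i s i)))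
    where
    s+2i : ∀ s i → s + 2 * i ≡ s + i + i
    s+2i = solve-∀

-- With A = [c, c + k) and A′ = [c′, c′ + k), c′ = c + y + w: B takes all of [0, c), the last y
-- points of A ∖ A′, the first x points of A ∩ A′, the first y points of A′ ∖ A and w + r points
-- after A ∪ A′, so it meets both A and A′ in x + y = i points; w ≤ s + i makes it fit in v.
commonNeighbour-runs : ∀ s c y w r x → w ≤ s + (y + x) →
  let i = y + x ; k = i + (c + (y + w) + r) ; v = 2 * k + s in
  ∃[ B ] Edge v k i (interval c k) B × Edge v k i B (interval (c + (y + w)) k)
commonNeighbour-runs s c y w r x w≤ =
  B , edge (∣interval∣ c k c+k≤v) ∣B∣≡k ∣A∩B∣≡i , edge ∣B∣≡k (∣interval∣ c′ k c′+k≤v) ∣B∩A′∣≡i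
  where
  i = y + x
  a = c + (y + w) + r
  k = i + a
  v = 2 * k + s
  c′ = c + (y + w)
  runs = (c , true) ∷ (w , false) ∷ (y , true) ∷ (x , true) ∷ (c + y + r , false) ∷
         (y , true) ∷ (w , false) ∷ (w + r , true) ∷ []
  B : Subset v
  B = ⟦ expand runs ⟧
  c+k≤v : c + k ≤ v
  c+k≤v = m≤n⇒m+n≤2*n+o s (≤-trans (≤-trans (m≤m+n c (y + w)) (m≤m+n c′ r)) (m≤n+m a i))
  c′+k≤v : c′ + k ≤ v
  c′+k≤v = m≤n⇒m+n≤2*n+o s (≤-trans (m≤m+n c′ r) (m≤n+m a i))
  fits : span runs ≤ v
  fits = ≤-trans (≤-reflexive (span≡ c y w r x)) (≤-trans (+-monoˡ-≤ _ w≤) (≤-reflexive (v≡ c y w r x s)))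
    where
    span≡ : ∀ c y w r x → c + (w + (y + (x + (c + y + r + (y + (w + (w + r + 0))))))) ≡
                          w + (c + y + x + c + y + r + y + w + w + r)
    span≡ = solve-∀
    v≡ : ∀ c y w r x s → s + (y + x) + (c + y + x + c + y + r + y + w + w + r) ≡
                         2 * (y + x + (c + (y + w) + r)) + s
    v≡ = solve-∀
  ∣B∣≡k : ∣ B ∣ ≡ k
  ∣B∣≡k = trans (∣⟦expand⟧∣≡weight runs fits) (weight≡ c y w r x)
    where
    weight≡ : ∀ c y w r x → c + (y + (x + (y + (w + r + 0)))) ≡ y + x + (c + (y + w) + r)
    weight≡ = solve-∀
  ∣A∩B∣≡i : ∣ interval c k ∩ B ∣ ≡ i
  ∣A∩B∣≡i = trans
    (∣interval∩⟦expand⟧∣ ((c , true) ∷ [])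
      ((w , false) ∷ (y , true) ∷ (x , true) ∷ (c + y + r , false) ∷ [])
      ((y , true) ∷ (w , false) ∷ (w + r , true) ∷ [])
      (+-identityʳ c) (window≡ c y w r x) c+k≤v)
    (cong (y +_) (+-identityʳ x))
    where
    window≡ : ∀ c y w r x → w + (y + (x + (c + y + r + 0))) ≡ y + x + (c + (y + w) + r)
    window≡ = solve-∀
  ∣B∩A′∣≡i : ∣ B ∩ interval c′ k ∣ ≡ i
  ∣B∩A′∣≡i = trans (cong ∣_∣ (∩-comm B (interval c′ k))) (trans
    (∣interval∩⟦expand⟧∣ ((c , true) ∷ (w , false) ∷ (y , true) ∷ [])
      ((x , true) ∷ (c + y + r , false) ∷ (y , true) ∷ (w , false) ∷ [])
      ((w + r , true) ∷ [])
      (offset≡ c y w) (window≡ c y w r x) c′+k≤v)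
    (trans (cong (x +_) (+-identityʳ y)) (+-comm x y)))
    where
    offset≡ : ∀ c y w → c + (w + (y + 0)) ≡ c + (y + w)
    offset≡ = solve-∀
    window≡ : ∀ c y w r x → x + (c + y + r + (y + (w + 0))) ≡ y + x + (c + (y + w) + r)
    window≡ = solve-∀

commonNeighbour : ∀ {i a s c c′} → c ≤ c′ → c′ ≤ a → c′ ≤ c + (s + 2 * i) →
  let k = i + a ; v = 2 * k + s in
  ∃[ B ] Edge v k i (interval c k) B × Edge v k i B (interval c′ k)
commonNeighbour {i} {a} {s} {c} c≤c′ c′≤a c′≤c+Δ
  with m≤n⇒∃[o]m+o≡n c≤c′ | m≤n⇒∃[o]m+o≡n c′≤a
... | t , refl | r , refl with shift-split {t} {s} {i} (+-cancelˡ-≤ c t _ c′≤c+Δ)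
... | y , w , refl , y≤i , w≤ with m≤n⇒∃[o]m+o≡n y≤i
... | x , refl = commonNeighbour-runs s c y w r x w≤

m≤ceilDiv[m,n]*n : ∀ m n .{{_ : NonZero n}} → m ≤ ceilDiv m n * n
m≤ceilDiv[m,n]*n m (suc δ) = +-cancelˡ-≤ δ m _ (begin
  δ + m                                       ≡⟨ +-comm δ m ⟩
  m + δ                                       ≡⟨ m≡m%n+[m/n]*n (m + δ) (suc δ) ⟩
  (m + δ) % suc δ + (m + δ) / suc δ * suc δ   ≤⟨ +-monoˡ-≤ _ (≤-pred (m%n<n (m + δ) (suc δ))) ⟩
  δ + (m + δ) / suc δ * suc δ                 ∎)
  where open ≤-Reasoning

ceilDiv-least : ∀ {m n} o .{{_ : NonZero n}} → m ≤ o * n → ceilDiv m n ≤ o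
ceilDiv-least {m} {suc δ} o m≤o*n = ≤-pred (m<n*o⇒m/o<n (begin-strict
  m + δ          ≤⟨ +-monoˡ-≤ δ m≤o*n ⟩
  o * suc δ + δ  <⟨ +-monoʳ-< (o * suc δ) ≤-refl ⟩
  o * suc δ + suc δ ≡⟨ +-comm (o * suc δ) (suc δ) ⟩
  suc o * suc δ  ∎))
  where open ≤-Reasoning

-- Consecutive offsets differ by at most Δ, so A j and A (suc j) have a common neighbour B j, and
-- A m = [a, a + k) meets A 0 = [0, k) in i points: A 0, B 0, A 1, …, B (m − 1), A m closes up
-- into a walk of length 2 m + 1.
module OddCycle (i a s : ℕ) .{{_ : NonZero a}} .{{_ : NonZero (s + 2 * i)}} where

  k = i + a
  v = 2 * k + s
  Δ = s + 2 * i
  m = ceilDiv a Δ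

  _~_ : Subset v → Subset v → Set
  _~_ = Edge v k i

  offset : ℕ → ℕ
  offset j = j * Δ ⊓ a

  A : ℕ → Subset v
  A j = interval (offset j) k

  neighbour : ∀ j → ∃[ B ] A j ~ B × B ~ A (suc j)
  neighbour j = commonNeighbour offset-mono (m⊓n≤n _ a) offset-step
    where
    offset-mono : offset j ≤ offset (suc j)
    offset-mono = ⊓-monoˡ-≤ a (m≤n+m (j * Δ) Δ)
    offset-step : offset (suc j) ≤ offset j + Δ
    offset-step = ≤-trans (⊓-mono-≤ (≤-reflexive (+-comm Δ (j * Δ))) (m≤m+n a Δ))
                          (≤-reflexive (sym (+-distribʳ-⊓ Δ (j * Δ) a)))

  B : ℕ → Subset v
  B j = proj₁ (neighbour j)

  offset-m : offset m ≡ a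
  offset-m = m≥n⇒m⊓n≡n (m≤ceilDiv[m,n]*n a Δ)

  closing : A m ~ A 0
  closing = subst (λ c → interval c k ~ A 0) (sym offset-m)
    (edge (∣interval∣ a k (m≤n⇒m+n≤2*n+o s (m≤n+m a i))) (∣interval∣ 0 k k≤v)
          (trans (cong ∣_∣ (∩-comm (interval {v} a k) (interval 0 k))) (∣interval∩shifted∣ i a k≤v)))
    where
    k≤v : k ≤ v
    k≤v = m≤n⇒m+n≤2*n+o s z≤n

  cycle : ℕ → Subset v
  cycle x = interleave A B (x % suc (2 * m))

  cycle-closedWalk : ClosedWalk _~_ (suc (2 * m)) cycle
  cycle-closedWalk = closedWalk-periodic _~_
    (λ x _ → interleave-edge _~_ (proj₁ ∘ proj₂ ∘ neighbour) (proj₂ ∘ proj₂ ∘ neighbour) x)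
    (subst (_~ A 0) (sym (interleave-2* A B m)) closing)

  oddClosedWalk-length : ∀ {n u} → Odd n → ClosedWalk _~_ n u → suc (2 * m) ≤ n
  oddClosedWalk-length odd closedWalk with Odd⇒≡1+2* odd
  ... | h , refl = s≤s (*-monoʳ-≤ 2 (ceilDiv-least h
                     (+-cancelˡ-≤ i a (h * Δ) (oddClosedWalk-bound {k} {s} {i} h closedWalk))))

  oddCycle : Cycle v k i (suc (2 * m))
  oddCycle = record
    { len≥3    = s≤s (*-monoʳ-≤ 2 (>-nonZero⁻¹ m {{m≢0}}))
    ; vert     = cycle
    ; isVert   = λ j j<n → source (proj₁ cycle-closedWalk j j<n)
    ; distinct = λ j l j<n l<n → shortestOddClosedWalk-injective _~_ (Odd-1+2* m) cycle-closedWalk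
                                   oddClosedWalk-length j<n l<n
    ; adj      = λ j j<n → adjacent (proj₁ cycle-closedWalk j j<n)
    ; closed   = proj₂ cycle-closedWalk
    }
    where
    m≢0 : NonZero m
    m≢0 = m*n≢0⇒m≢0 m {{>-nonZero (<-≤-trans (>-nonZero⁻¹ a) (m≤ceilDiv[m,n]*n a Δ))}}

  oddGirth : OddGirth v k i (suc (2 * m))
  oddGirth = (Odd-1+2* m , oddCycle) , λ n odd C → oddClosedWalk-length odd (cycle⇒closedWalk C)

lemma5p4 : (v k i : ℕ) → i < k → k < v → 2 * k ≤ v →
    ¬ (v ≡ 2 * k × i ≡ 0) →
    Girth v k i 4 →
    OddGirth v k i (2 * ceilDiv (k ∸ i) (v ∸ 2 * k + 2 * i) + 1)
lemma5p4 v k i i<k _ 2k≤v not-2k-k-0 _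
  with m≤n⇒∃[o]m+o≡n (<⇒≤ i<k) | m≤n⇒∃[o]m+o≡n 2k≤v
... | a , refl | s , refl =
  subst (OddGirth (2 * (i + a) + s) (i + a) i) formula (OddCycle.oddGirth i a s {{a≢0}} {{Δ≢0}})
  where
  a≢0 : NonZero a
  a≢0 = ≢-nonZero λ a≡0 → <-irrefl (sym (trans (cong (i +_) a≡0) (+-identityʳ i))) i<k
  Δ≢0 : NonZero (s + 2 * i)
  Δ≢0 = ≢-nonZero λ Δ≡0 → not-2k-k-0
    ( trans (cong (2 * (i + a) +_) (m+n≡0⇒m≡0 s Δ≡0)) (+-identityʳ _)
    , m+n≡0⇒m≡0 i (m+n≡0⇒n≡0 s Δ≡0))
  formula : suc (2 * ceilDiv a (s + 2 * i)) ≡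
            2 * ceilDiv (i + a ∸ i) (2 * (i + a) + s ∸ 2 * (i + a) + 2 * i) + 1
  formula = trans (+-comm 1 _)
    (cong₂ (λ x y → 2 * ceilDiv x (y + 2 * i) + 1) (sym (m+n∸m≡n i a)) (sym (m+n∸m≡n (2 * (i + a)) s)))
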